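{- Let $n\ge1$ and let $p$ be an integer with $n/2<p\le n$. Starting from $n$ closed lockers numbered $1,\dots,n$, let exactly the students $a_1,\dots,a_p$ act, each once. Then the number $\omega$ of open lockers afterwards is $\omega=\theta(p)+\big((n-p)-(\theta(n)-\theta(p))\big)$, where $\theta(m)=\lfloor\sqrt m\rfloor$.
   Context: Locker problem: student $a_i$ acting changes the state (open/closed) of every locker whose number is a multiple of $i$. -}

module Defs where

open import Data.Nat using (ℕ; zero; suc; _*_; _≤_; _≤?_)
open import Data.Nat.Divisibility using (_∣?_)
open import Data.Bool using (Bool; true; false; not; if_then_else_)
open import Data.List using (List; length; filter; upTo; map)
open import Relation.Nullary.Decidable using (does)
open import Relation.Binary.PropositionalEquality using (_≡_)
open import Data.Bool.Properties using (_≟_)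

lockerState : ℕ → ℕ → Bool
lockerState zero    j = false
lockerState (suc i) j = if does (suc i ∣? j) then not (lockerState i j) else lockerState i j

lockers : ℕ → List ℕ
lockers n = map suc (upTo n)

openCount : ℕ → ℕ → ℕ
openCount n p = length (filter (λ j → lockerState p j ≟ true) (lockers n))

-- θ(m) = ⌊√m⌋: the largest k with k*k ≤ m.
θ : ℕ → ℕ
θ zero = zero
θ (suc m) = if does (suc (θ m) * suc (θ m) ≤? suc m) then suc (θ m) else θ m

-- Locker j ends open iff j has an odd number of divisors among 1,…,p.  Such
-- parities are handled as xor-sums over {1,…,j} (xorSum).  Writing the test
-- "a ∣ j" as the xor-sum over b of [a·b = j] turns the divisor parity of j into
-- a double sum of the symmetric indicator [a·b = j]; its off-diagonal terms
-- cancel in pairs, so j has an odd number of divisors iff j is a perfect square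
-- (lockerState-self).  Students beyond j never touch locker j, so for j ≤ p it
-- is open iff j is a square (lockerState-settled); for p < j < 2p every divisor
-- of j except j itself is at most p, so it is open iff j is not a square
-- (lockerState-unsettled).  Since θ grows by one exactly at the squares
-- (θ-suc), counting gives θ p open lockers among 1,…,p and, with k = n − p,
-- ω + (θ n − θ p) = θ p + k (openCount-unsettled).  Solving for ω, using
-- θ n − θ p ≤ k, yields theorem9.
module Submission where

open import Defs
open import Data.Nat using (ℕ; _+_; _∸_; _*_; _≤_; _<_)
open import Relation.Binary.PropositionalEquality using (_≡_)

open import Data.Nat using (zero; suc; z≤n; s≤s; _≡ᵇ_; _≤?_; >-nonZero⁻¹)
open import Data.Nat.Properties
open import Data.Nat.Divisibility
  using (_∣_; _∣?_; divides; ∣-refl; ∣⇒≤; quotient; quotient≢0; quotient-∣; quotient>1;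
         m∣n⇒n≡m*quotient; m∣n⇒n≡quotient*m)
open import Data.Nat.Tactic.RingSolver using (solve-∀)
open import Data.Bool using (Bool; true; false; not; _xor_; T; if_then_else_)
open import Data.Bool.Properties using (xor-assoc; xor-same; not-involutive; xor-∧-commutativeRing)
open import Algebra.Bundles using (CommutativeRing)
open import Algebra.Properties.CommutativeSemigroup
  (CommutativeRing.+-commutativeSemigroup xor-∧-commutativeRing)
  using () renaming (interchange to xor-interchange)
import Data.Bool.Properties as Bool
open import Data.List using (List; [_]; filter; length; map; upTo; _++_)
import Data.List.Properties as List
open import Data.Sum using (inj₁; inj₂)
open import Data.Unit using (tt)
open import Data.Empty using (⊥-elim)
open import Relation.Nullary using (¬_; Dec; yes; no; does)
open import Relation.Binary.Definitions using (tri<; tri≈; tri>)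
open import Relation.Binary.PropositionalEquality
  using (refl; sym; trans; cong; cong₂; subst; module ≡-Reasoning)

xorSum : ℕ → (ℕ → Bool) → Bool
xorSum zero    f = false
xorSum (suc j) f = f (suc j) xor xorSum j f

private
  variable
    a c i i′ j m p r : ℕ
    f g : ℕ → Bool

xorSum-cong : (∀ a → 1 ≤ a → a ≤ j → f a ≡ g a) → xorSum j f ≡ xorSum j g
xorSum-cong {zero}  eq = refl
xorSum-cong {suc j} eq =
  cong₂ _xor_ (eq (suc j) (s≤s z≤n) ≤-refl) (xorSum-cong (λ a 1≤a a≤j → eq a 1≤a (m≤n⇒m≤1+n a≤j)))

xorSum-xor : ∀ j → xorSum j (λ a → f a xor g a) ≡ xorSum j f xor xorSum j g
xorSum-xor zero = refl
xorSum-xor {f} {g} (suc j) = begin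
  (f (suc j) xor g (suc j)) xor xorSum j (λ a → f a xor g a)
    ≡⟨ cong ((f (suc j) xor g (suc j)) xor_) (xorSum-xor j) ⟩
  (f (suc j) xor g (suc j)) xor (xorSum j f xor xorSum j g)
    ≡⟨ xor-interchange (f (suc j)) (g (suc j)) (xorSum j f) (xorSum j g) ⟩
  (f (suc j) xor xorSum j f) xor (g (suc j) xor xorSum j g) ∎
  where open ≡-Reasoning

xorSum-none : (∀ a → 1 ≤ a → a ≤ j → ¬ T (f a)) → xorSum j f ≡ false
xorSum-none {zero}      none = refl
xorSum-none {suc j} {f} none with f (suc j) in eq
... | true  = ⊥-elim (none (suc j) (s≤s z≤n) ≤-refl (subst T (sym eq) tt))
... | false = xorSum-none (λ a 1≤a a≤j → none a 1≤a (m≤n⇒m≤1+n a≤j))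

xorSum-unique : 1 ≤ a → a ≤ j → T (f a) → (∀ b → 1 ≤ b → b ≤ j → T (f b) → b ≡ a) →
                xorSum j f ≡ true
xorSum-unique {j = zero} (s≤s _) ()
xorSum-unique {a} {suc j} {f} 1≤a a≤1+j fa only with m≤n⇒m<n∨m≡n a≤1+j | f (suc j) in eq
... | inj₂ refl       | true  = cong not (xorSum-none λ b 1≤b b≤j fb →
                                   <-irrefl (only b 1≤b (m≤n⇒m≤1+n b≤j) fb) (s≤s b≤j))
... | inj₂ refl       | false = ⊥-elim (subst T eq fa)
... | inj₁ (s≤s a≤j) | true  =
  ⊥-elim (<-irrefl (sym (only (suc j) (s≤s z≤n) ≤-refl (subst T (sym eq) tt))) (s≤s a≤j))
... | inj₁ (s≤s a≤j) | false =
  xorSum-unique 1≤a a≤j fa (λ b 1≤b b≤j → only b 1≤b (m≤n⇒m≤1+n b≤j))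

-- For symmetric F the off-diagonal terms of the double sum over {1,…,j}²
-- cancel in pairs (a,b),(b,a), leaving the diagonal.
xorSum-symmetric : (F : ℕ → ℕ → Bool) → (∀ a b → F a b ≡ F b a) → ∀ j →
                   xorSum j (λ a → xorSum j (F a)) ≡ xorSum j (λ a → F a a)
xorSum-symmetric F F-sym zero    = refl
xorSum-symmetric F F-sym (suc j) = begin
  (d xor row) xor xorSum j (λ a → F a (suc j) xor xorSum j (F a))
    ≡⟨ cong ((d xor row) xor_) (xorSum-xor j) ⟩
  (d xor row) xor (column xor square)
    ≡⟨ cong (λ c → (d xor row) xor (c xor square)) column≡row ⟩
  (d xor row) xor (row xor square)
    ≡⟨ xor-assoc d row (row xor square) ⟩
  d xor (row xor (row xor square))
    ≡⟨ cong (d xor_) (sym (xor-assoc row row square)) ⟩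
  d xor ((row xor row) xor square)
    ≡⟨ cong (λ r → d xor (r xor square)) (xor-same row) ⟩
  d xor square
    ≡⟨ cong (d xor_) (xorSum-symmetric F F-sym j) ⟩
  d xor xorSum j (λ a → F a a) ∎
  where
  open ≡-Reasoning
  d row column square : Bool
  d      = F (suc j) (suc j)
  row    = xorSum j (F (suc j))
  column = xorSum j (λ a → F a (suc j))
  square = xorSum j (λ a → xorSum j (F a))
  column≡row : column ≡ row
  column≡row = xorSum-cong {j} (λ a _ _ → F-sym a (suc j))

-- isSquare j = true iff j is a positive perfect square: j has at most one
-- square root, so this parity counts it.
isSquare : ℕ → Bool
isSquare j = xorSum j (λ a → a * a ≡ᵇ j)

-- Stated for an arbitrary decision of a ∣ j, so that it applies to a ∣? j.
divides-as-xorSum : 1 ≤ a → 1 ≤ j → (a∣?j : Dec (a ∣ j)) →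
                    does a∣?j ≡ xorSum j (λ b → a * b ≡ᵇ j)
divides-as-xorSum {a@(suc _)} {j@(suc _)} _ _ (no a∤j) =
  sym (xorSum-none {j = j} λ b _ _ ab≡j →
    a∤j (divides b (trans (sym (≡ᵇ⇒≡ (a * b) j ab≡j)) (*-comm a b))))
divides-as-xorSum {a@(suc _)} {j@(suc _)} _ _ (yes a∣j) =
  sym (xorSum-unique {j = j} 1≤q q≤j (≡⇒≡ᵇ (a * q) j (sym j≡aq)) only-q)
  where
  q : ℕ
  q = quotient a∣j
  j≡aq : j ≡ a * q
  j≡aq = m∣n⇒n≡m*quotient a∣j
  1≤q : 1 ≤ q
  1≤q = >-nonZero⁻¹ q {{quotient≢0 a∣j}}
  q≤j : q ≤ j
  q≤j = ∣⇒≤ (quotient-∣ a∣j)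
  only-q : ∀ b → 1 ≤ b → b ≤ j → T (a * b ≡ᵇ j) → b ≡ q
  only-q b _ _ ab≡j = *-cancelˡ-≡ b q a (trans (≡ᵇ⇒≡ (a * b) j ab≡j) j≡aq)

lockerState-xorSum : ∀ i j → lockerState i j ≡ xorSum i (λ k → does (k ∣? j))
lockerState-xorSum zero    j = refl
lockerState-xorSum (suc i) j with does (suc i ∣? j)
... | true  = cong not (lockerState-xorSum i j)
... | false = lockerState-xorSum i j

-- Once every student up to j has acted, locker j is open iff j is a perfect
-- square: the divisor pairs (a, j/a) cancel except the diagonal a = j/a.
lockerState-self : ∀ j → lockerState j j ≡ isSquare j
lockerState-self j = begin
  lockerState j j
    ≡⟨ lockerState-xorSum j j ⟩
  xorSum j (λ a → does (a ∣? j))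
    ≡⟨ xorSum-cong {j} (λ a 1≤a a≤j → divides-as-xorSum 1≤a (≤-trans 1≤a a≤j) (a ∣? j)) ⟩
  xorSum j (λ a → xorSum j (λ b → a * b ≡ᵇ j))
    ≡⟨ xorSum-symmetric (λ a b → a * b ≡ᵇ j) (λ a b → cong (_≡ᵇ j) (*-comm a b)) j ⟩
  isSquare j ∎
  where open ≡-Reasoning

record IsRoot (r m : ℕ) : Set where
  constructor isRoot
  field
    lower : r * r ≤ m
    upper : m < suc r * suc r

isRoot-step : IsRoot r m → (test : Dec (suc r * suc r ≤ suc m)) →
              IsRoot (if does test then suc r else r) (suc m)
isRoot-step {r} (isRoot _ m<[1+r]²) (yes [1+r]²≤1+m) =
  isRoot [1+r]²≤1+m (≤-<-trans m<[1+r]² (*-mono-< (n<1+n (suc r)) (n<1+n (suc r))))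
isRoot-step (isRoot r²≤m _) (no [1+r]²≰1+m) = isRoot (m≤n⇒m≤1+n r²≤m) (≰⇒> [1+r]²≰1+m)

θ-isRoot : ∀ m → IsRoot (θ m) m
θ-isRoot zero    = isRoot z≤n (s≤s z≤n)
θ-isRoot (suc m) = isRoot-step (θ-isRoot m) (suc (θ m) * suc (θ m) ≤? suc m)

root-of-suc : ∀ {b} → IsRoot r m → b * b ≡ suc m → b ≡ suc r
root-of-suc {r} {m} {b} (isRoot r²≤m m<[1+r]²) b²≡1+m with <-cmp b (suc r)
... | tri≈ _ b≡1+r _ = b≡1+r
... | tri< (s≤s b≤r) _ _ = ⊥-elim (1+n≰n (begin
  suc m   ≡⟨ sym b²≡1+m ⟩
  b * b   ≤⟨ *-mono-≤ b≤r b≤r ⟩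
  r * r   ≤⟨ r²≤m ⟩
  m       ∎))
  where open ≤-Reasoning
... | tri> _ _ 1+r<b = ⊥-elim (<-irrefl refl (begin-strict
  suc r * suc r              <⟨ *-mono-< (n<1+n (suc r)) (n<1+n (suc r)) ⟩
  suc (suc r) * suc (suc r)  ≤⟨ *-mono-≤ 1+r<b 1+r<b ⟩
  b * b                      ≡⟨ b²≡1+m ⟩
  suc m                      ≤⟨ m<[1+r]² ⟩
  suc r * suc r              ∎))
  where open ≤-Reasoning

isRoot-test : IsRoot r m → (test : Dec (suc r * suc r ≤ suc m)) → does test ≡ isSquare (suc m)
isRoot-test {r} {m} root (yes [1+r]²≤1+m) =
  sym (xorSum-unique {j = suc m} (s≤s z≤n) 1+r≤1+m (≡⇒≡ᵇ (suc r * suc r) (suc m) [1+r]²≡1+m)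
        (λ b _ _ b²≡1+m → root-of-suc {b = b} root (≡ᵇ⇒≡ (b * b) (suc m) b²≡1+m)))
  where
  [1+r]²≡1+m : suc r * suc r ≡ suc m
  [1+r]²≡1+m = ≤-antisym [1+r]²≤1+m (IsRoot.upper root)
  1+r≤1+m : suc r ≤ suc m
  1+r≤1+m = subst (suc r ≤_) [1+r]²≡1+m (m≤m*n (suc r) (suc r))
isRoot-test {r} {m} root (no [1+r]²≰1+m) =
  sym (xorSum-none {j = suc m} λ b _ _ b²≡1+m → [1+r]²≰1+m (≤-reflexive (square-root b b²≡1+m)))
  where
  open ≡-Reasoning
  square-root : ∀ b → T (b * b ≡ᵇ suc m) → suc r * suc r ≡ suc m
  square-root b b²≡1+m = begin
    suc r * suc r  ≡⟨ cong (λ x → x * x) (sym (root-of-suc {b = b} root b²≡1+m′)) ⟩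
    b * b          ≡⟨ b²≡1+m′ ⟩
    suc m          ∎
    where
    b²≡1+m′ : b * b ≡ suc m
    b²≡1+m′ = ≡ᵇ⇒≡ (b * b) (suc m) b²≡1+m

bit : Bool → ℕ
bit true  = 1
bit false = 0

θ-suc : ∀ m → θ (suc m) ≡ θ m + bit (isSquare (suc m))
θ-suc m =
  trans (if-bit (does test) (θ m)) (cong (λ s → θ m + bit s) (isRoot-test (θ-isRoot m) test))
  where
  test : Dec (suc (θ m) * suc (θ m) ≤ suc m)
  test = suc (θ m) * suc (θ m) ≤? suc m
  if-bit : ∀ b x → (if b then suc x else x) ≡ x + bit b
  if-bit true  x = +-comm 1 x
  if-bit false x = sym (+-identityʳ x)

θ-monotone : ∀ m k → θ m ≤ θ (m + k)
θ-monotone m zero    = ≤-reflexive (cong θ (sym (+-identityʳ m)))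
θ-monotone m (suc k) = begin
  θ m                                      ≤⟨ θ-monotone m k ⟩
  θ (m + k)                                ≤⟨ m≤m+n (θ (m + k)) _ ⟩
  θ (m + k) + bit (isSquare (suc (m + k))) ≡⟨ sym (θ-suc (m + k)) ⟩
  θ (suc (m + k))                          ≡⟨ cong θ (sym (+-suc m k)) ⟩
  θ (m + suc k)                            ∎
  where open ≤-Reasoning

θ-lipschitz : ∀ m k → θ (m + k) ≤ θ m + k
θ-lipschitz m zero    = ≤-reflexive (trans (cong θ (+-identityʳ m)) (sym (+-identityʳ (θ m))))
θ-lipschitz m (suc k) = begin
  θ (m + suc k)                            ≡⟨ cong θ (+-suc m k) ⟩
  θ (suc (m + k))                          ≡⟨ θ-suc (m + k) ⟩
  θ (m + k) + bit (isSquare (suc (m + k))) ≤⟨ +-monoʳ-≤ (θ (m + k)) (bit≤1 _) ⟩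
  θ (m + k) + 1                            ≤⟨ +-monoˡ-≤ 1 (θ-lipschitz m k) ⟩
  (θ m + k) + 1                            ≡⟨ +-assoc (θ m) k 1 ⟩
  θ m + (k + 1)                            ≡⟨ cong (θ m +_) (+-comm k 1) ⟩
  θ m + suc k                              ∎
  where
  open ≤-Reasoning
  bit≤1 : ∀ b → bit b ≤ 1
  bit≤1 true  = ≤-refl
  bit≤1 false = z≤n

lockerState-frozen : i ≤ i′ → (∀ c → i < c → c ≤ i′ → ¬ c ∣ j) →
                     lockerState i′ j ≡ lockerState i j
lockerState-frozen {i′ = zero} z≤n _ = refl
lockerState-frozen {i} {suc i′} {j} i≤1+i′ no-divisor with m≤n⇒m<n∨m≡n i≤1+i′
... | inj₂ refl = refl
... | inj₁ (s≤s i≤i′) =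
  trans (untouched (suc i′ ∣? j) (no-divisor (suc i′) (s≤s i≤i′) ≤-refl))
        (lockerState-frozen i≤i′ (λ c i<c c≤i′ → no-divisor c i<c (m≤n⇒m≤1+n c≤i′)))
  where
  untouched : (test : Dec (suc i′ ∣ j)) → ¬ suc i′ ∣ j →
              (if does test then not (lockerState i′ j) else lockerState i′ j) ≡ lockerState i′ j
  untouched (yes d) ¬d = ⊥-elim (¬d d)
  untouched (no _)  _  = refl

-- Students beyond j never touch locker j, so for j ≤ p its state is final.
lockerState-settled : 1 ≤ j → j ≤ p → lockerState p j ≡ isSquare j
lockerState-settled {j@(suc _)} _ j≤p =
  trans (lockerState-frozen j≤p (λ c j<c _ c∣j → <⇒≱ j<c (∣⇒≤ c∣j))) (lockerState-self j)

proper-divisor : c ∣ j → c < j → 2 * c ≤ j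
proper-divisor {c} {j} c∣j c<j = begin
  2 * c              ≤⟨ *-monoˡ-≤ c (quotient>1 c∣j c<j) ⟩
  quotient c∣j * c   ≡⟨ sym (m∣n⇒n≡quotient*m c∣j) ⟩
  j                  ∎
  where open ≤-Reasoning

-- For p < j < 2p every divisor of j except j itself is at most p, so students
-- a₁,…,a_p leave locker j in the state opposite to its final one.
lockerState-unsettled : p < j → j < 2 * p → lockerState p j ≡ not (isSquare j)
lockerState-unsettled {p} {suc m} (s≤s p≤m) j<2p = begin
  lockerState p (suc m)              ≡⟨ sym (lockerState-frozen p≤m no-divisor) ⟩
  lockerState m (suc m)              ≡⟨ sym (not-involutive _) ⟩
  not (not (lockerState m (suc m)))  ≡⟨ cong not (sym (self-toggle (suc m ∣? suc m))) ⟩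
  not (lockerState (suc m) (suc m))  ≡⟨ cong not (lockerState-self (suc m)) ⟩
  not (isSquare (suc m))             ∎
  where
  open ≡-Reasoning
  self-toggle : (test : Dec (suc m ∣ suc m)) →
                (if does test then not (lockerState m (suc m)) else lockerState m (suc m)) ≡
                not (lockerState m (suc m))
  self-toggle (yes _)  = refl
  self-toggle (no ¬d) = ⊥-elim (¬d ∣-refl)
  no-divisor : ∀ c → p < c → c ≤ m → ¬ c ∣ suc m
  no-divisor c p<c c≤m c∣j =
    <-asym j<2p (<-≤-trans (*-monoʳ-< 2 p<c) (proper-divisor c∣j (s≤s c≤m)))

openCount-suc : ∀ n p → openCount (suc n) p ≡ openCount n p + bit (lockerState p (suc n))
openCount-suc n p = begin
  count (map suc (upTo (suc n)))
    ≡⟨ cong (λ xs → count (map suc xs)) (sym (List.upTo-∷ʳ n)) ⟩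
  count (map suc (upTo n ++ [ n ]))
    ≡⟨ cong count (List.map-++ suc (upTo n) [ n ]) ⟩
  count (map suc (upTo n) ++ [ suc n ])
    ≡⟨ cong length (List.filter-++ isOpen? (map suc (upTo n)) [ suc n ]) ⟩
  length (filter isOpen? (map suc (upTo n)) ++ filter isOpen? [ suc n ])
    ≡⟨ List.length-++ (filter isOpen? (map suc (upTo n))) ⟩
  openCount n p + count [ suc n ]
    ≡⟨ cong (openCount n p +_) (count-singleton (suc n)) ⟩
  openCount n p + bit (lockerState p (suc n)) ∎
  where
  open ≡-Reasoning
  isOpen? : (j : ℕ) → Dec (lockerState p j ≡ true)
  isOpen? j = lockerState p j Bool.≟ true
  count : List ℕ → ℕ
  count xs = length (filter isOpen? xs)
  count-singleton : ∀ j → count [ j ] ≡ bit (lockerState p j)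
  count-singleton j with lockerState p j
  ... | true  = refl
  ... | false = refl

openCount-settled : m ≤ p → openCount m p ≡ θ m
openCount-settled {zero}      _     = refl
openCount-settled {suc m} {p} 1+m≤p = begin
  openCount (suc m) p                          ≡⟨ openCount-suc m p ⟩
  openCount m p + bit (lockerState p (suc m))  ≡⟨ cong₂ (λ x s → x + bit s)
                                                   (openCount-settled (<⇒≤ 1+m≤p))
                                                   (lockerState-settled (s≤s z≤n) 1+m≤p) ⟩
  θ m + bit (isSquare (suc m))                 ≡⟨ sym (θ-suc m) ⟩
  θ (suc m)                                    ∎
  where open ≡-Reasoning

-- Each locker j with p < j < 2p is open iff it is not a square, so the open
-- lockers and the squares among p+1,…,p+k together number k.
openCount-unsettled : ∀ k → p + k < 2 * p → openCount (p + k) p + (θ (p + k) ∸ θ p) ≡ θ p + k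
openCount-unsettled {p} zero _ = begin
  openCount (p + 0) p + (θ (p + 0) ∸ θ p)
    ≡⟨ cong (λ m → openCount m p + (θ m ∸ θ p)) (+-identityʳ p) ⟩
  openCount p p + (θ p ∸ θ p)
    ≡⟨ cong₂ _+_ (openCount-settled {p} ≤-refl) (n∸n≡0 (θ p)) ⟩
  θ p + 0 ∎
  where open ≡-Reasoning
openCount-unsettled {p} (suc k) p+1+k<2p rewrite +-suc p k = begin
  openCount (suc q) p + (θ (suc q) ∸ θ p)
    ≡⟨ cong₂ (λ x y → x + (y ∸ θ p)) (openCount-suc q p) (θ-suc q) ⟩
  (openCount q p + bit (lockerState p (suc q))) + ((θ q + bit square) ∸ θ p)
    ≡⟨ cong₂ (λ s y → (openCount q p + bit s) + y)
         (lockerState-unsettled (s≤s (m≤m+n p k)) p+1+k<2p)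
         (+-∸-comm (bit square) (θ-monotone p k)) ⟩
  (openCount q p + bit (not square)) + ((θ q ∸ θ p) + bit square)
    ≡⟨ bit-complement square (openCount q p) (θ q ∸ θ p) ⟩
  suc (openCount q p + (θ q ∸ θ p))
    ≡⟨ cong suc (openCount-unsettled k (<-trans (n<1+n q) p+1+k<2p)) ⟩
  suc (θ p + k)
    ≡⟨ sym (+-suc (θ p) k) ⟩
  θ p + suc k ∎
  where
  open ≡-Reasoning
  q : ℕ
  q = p + k
  square : Bool
  square = isSquare (suc q)
  bit-complement : ∀ s x y → (x + bit (not s)) + (y + bit s) ≡ suc (x + y)
  bit-complement true  = solve-∀
  bit-complement false = solve-∀

+-cancel-∸ : ∀ x y {e k} → x + e ≡ y + k → e ≤ k → x ≡ y + (k ∸ e)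
+-cancel-∸ x y {e} {k} x+e≡y+k e≤k = begin
  x            ≡⟨ sym (m+n∸n≡m x e) ⟩
  x + e ∸ e    ≡⟨ cong (_∸ e) x+e≡y+k ⟩
  y + k ∸ e    ≡⟨ +-∸-assoc y e≤k ⟩
  y + (k ∸ e)  ∎
  where open ≡-Reasoning

theorem9 : (n p : ℕ) → 1 ≤ n → n < 2 * p → p ≤ n →
    openCount n p ≡ θ p + ((n ∸ p) ∸ (θ n ∸ θ p))
theorem9 n p _ n<2p p≤n = begin
  openCount n p                          ≡⟨ cong (λ m → openCount m p) (sym p+k≡n) ⟩
  openCount (p + k) p                    ≡⟨ +-cancel-∸ (openCount (p + k) p) (θ p)
                                              (openCount-unsettled k p+k<2p)
                                              (m≤n+o⇒m∸n≤o (θ (p + k)) (θ p) (θ-lipschitz p k)) ⟩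
  θ p + (k ∸ (θ (p + k) ∸ θ p))          ≡⟨ cong (λ m → θ p + (k ∸ (θ m ∸ θ p))) p+k≡n ⟩
  θ p + ((n ∸ p) ∸ (θ n ∸ θ p))          ∎
  where
  open ≡-Reasoning
  k : ℕ
  k = n ∸ p
  p+k≡n : p + k ≡ n
  p+k≡n = m+[n∸m]≡n p≤n
  p+k<2p : p + k < 2 * p
  p+k<2p = subst (_< 2 * p) (sym p+k≡n) n<2p
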